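{- Let $i<n$ and suppose $\hat u_i$ is not colored. If $\hat u_j\ne\hat u_i$ is a colored node in the complete subtree rooted at $\hat u_i$ such that no node on the path from $\hat u_i$ to $\hat u_j$ other than $\hat u_j$ is colored, then $\hat u_j$ is red and not blue.
   Context: A trie is a rooted tree with $n$ nodes whose edges are labeled with characters of $\Sigma$, totally ordered by $\prec$, such that the edges leaving any node carry pairwise distinct labels. $\lambda(\hat u)$ is the label of the edge entering $\hat u$ (the root gets $\#$, the smallest character, labeling no edge) and $out(\hat u)$ is the set of labels of edges leaving $\hat u$. Nodes are sorted co-lexicographically (root-to-node label strings compared right-to-left with $\prec$): $\hat u_1<\dots<\hat u_n$. For $i<n$, $\hat u_i$ is red if $out(\hat u_i)\ne out(\hat u_{i+1})$, blue if $\lambda(\hat u_i)\ne\lambda(\hat u_{i+1})$, and colored if red or blue; $\hat u_n$ is not colored. The complete subtree rooted at $\hat u$ consists of $\hat u$ and all its descendants. -}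

module Defs where

open import Data.List using (List; []; _∷_; _++_; _∷ʳ_; reverse; last)
open import Data.List.Membership.Propositional using (_∈_)
open import Data.List.Relation.Unary.Unique.Propositional using (Unique)
open import Data.Maybe using (Maybe)
open import Data.Product using (Σ; ∃; _×_)
open import Data.Sum using (_⊎_)
open import Relation.Nullary using (¬_)
open import Relation.Binary.PropositionalEquality using (_≡_; _≢_)
open import Function.Bundles using (_⇔_)

-- A trie over alphabet A, represented (up to isomorphism) by the finite set of
-- root-to-node label strings of its nodes.  Since edges leaving a node carry
-- pairwise distinct labels, a node is determined by its string; the node set
-- is prefix-closed and contains the root (empty string).
record Trie (A : Set) : Set where
  field
    nodes         : List (List A)
    unique        : Unique nodes
    root∈         : [] ∈ nodes
    prefix-closed : ∀ (s : List A) (c : A) → (s ∷ʳ c) ∈ nodes → s ∈ nodes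
open Trie public

module _ {A : Set} where

  -- λ(u): label of the edge entering u; the root gets # (modelled as nothing,
  -- which is distinct from every edge label).
  λ-label : List A → Maybe A
  λ-label = last

  Out : Trie A → List A → A → Set
  Out T u c = (u ∷ʳ c) ∈ nodes T

  _⊑_ : List A → List A → Set
  u ⊑ v = ∃ λ w → u ++ w ≡ v

module _ {A : Set} (_≺_ : A → A → Set) where

  data Lex : List A → List A → Set where
    []<∷  : ∀ {y ys} → Lex [] (y ∷ ys)
    here  : ∀ {x y xs ys} → x ≺ y → Lex (x ∷ xs) (y ∷ ys)
    there : ∀ {x xs ys} → Lex xs ys → Lex (x ∷ xs) (x ∷ ys)

  -- co-lexicographic order: compare strings right to left
  -- (equivalently: strings prefixed by the smallest character #)
  _<co_ : List A → List A → Set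
  s <co t = Lex (reverse s) (reverse t)

  -- v is the co-lexicographic successor of u among the nodes of T
  -- (i.e. u = û_i and v = û_{i+1})
  Succ : Trie A → List A → List A → Set
  Succ T u v = (u ∈ nodes T) × (v ∈ nodes T) × (u <co v)
             × (∀ w → w ∈ nodes T → u <co w → ¬ (w <co v))

  Red : Trie A → List A → Set
  Red T u = ∃ λ v → Succ T u v × ¬ (∀ c → Out T u c ⇔ Out T v c)

  Blue : Trie A → List A → Set
  Blue T u = ∃ λ v → Succ T u v × λ-label u ≢ λ-label v

  Colored : Trie A → List A → Set
  Colored T u = Red T u ⊎ Blue T u

-- Once û_i is not colored, its successor û_{i+1} has the same outgoing labels, so for every child
-- label c the nodes û_i c and û_{i+1} c are again co-lexicographic neighbours (no node fits between
-- them, since anything in between would end in c and its parent would fit between û_i and û_{i+1}).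
-- Following the uncolored path from û_i down to û_j = û_i z, the successor of û_j is û_{i+1} z.
-- As z is nonempty both end in the same label, so û_j is not blue; being colored, it is red.
module Submission where

open import Defs
open import Data.List using (List; []; _∷_; _++_; _∷ʳ_; reverse; last)
open import Data.List.Properties
  using (++-assoc; ++-identityʳ; ++-identityʳ-unique; ++-cancelˡ; reverse-++; reverse-injective; ≡-dec)
open import Data.List.Reverse using (Reverse; []; _∶_∶ʳ_; reverseView)
open import Data.List.Membership.Propositional using (_∈_)
import Data.List.Membership.DecPropositional as DecMembership
open import Data.Product using (∃; _×_; _,_; map₂)
open import Data.Sum using (_⊎_; inj₁; inj₂; [_,_]′)
open import Data.Empty using (⊥-elim)
open import Function using (_∘_; id)
open import Function.Bundles using (Equivalence)
open import Relation.Nullary using (¬_; yes; no)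
open import Relation.Binary.PropositionalEquality using (_≡_; _≢_; refl; sym; trans; cong; subst₂)
open import Relation.Binary.Structures using (IsStrictTotalOrder)
open import Relation.Binary.Definitions using (tri<; tri≈; tri>)

module _ {A : Set} where

  ⊑-refl : ∀ {s : List A} → s ⊑ s
  ⊑-refl {s} = [] , ++-identityʳ s

  ⊑-trans : ∀ {s t r : List A} → s ⊑ t → t ⊑ r → s ⊑ r
  ⊑-trans {s} (w , refl) (w′ , refl) = w ++ w′ , sym (++-assoc s w w′)

  ⊑-∷ʳ : ∀ {s : List A} {c} → s ⊑ (s ∷ʳ c)
  ⊑-∷ʳ {c = c} = c ∷ [] , refl

  ++⁺-⊑ : ∀ (s : List A) {t r} → t ⊑ r → (s ++ t) ⊑ (s ++ r)
  ++⁺-⊑ s {t} (w , refl) = w , ++-assoc s t w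

  _⊏_ : List A → List A → Set
  s ⊏ t = ∃ λ c → (s ∷ʳ c) ⊑ t

  ⊏⇒⊑ : ∀ {s t : List A} → s ⊏ t → s ⊑ t
  ⊏⇒⊑ (_ , s∷ʳc⊑t) = ⊑-trans ⊑-∷ʳ s∷ʳc⊑t

  ⊏⇒≢ : ∀ {s t : List A} → s ⊏ t → s ≢ t
  ⊏⇒≢ {s} (c , w , eq) refl with () ← ++-identityʳ-unique s (sym (trans (sym (++-assoc s (c ∷ []) w)) eq))

  ⊏-∷ʳ : ∀ {s t : List A} {c} → s ⊏ t → s ⊏ (t ∷ʳ c)
  ⊏-∷ʳ = map₂ (λ s∷ʳd⊑t → ⊑-trans s∷ʳd⊑t ⊑-∷ʳ)

  last-++-∷ : ∀ (s : List A) c w → last (s ++ c ∷ w) ≡ last (c ∷ w)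
  last-++-∷ []           c w = refl
  last-++-∷ (_ ∷ [])     c w = refl
  last-++-∷ (_ ∷ d ∷ s)  c w = last-++-∷ (d ∷ s) c w

  λ-label-++ : ∀ (s t : List A) {w} → w ≢ [] → λ-label (s ++ w) ≡ λ-label (t ++ w)
  λ-label-++ s t {[]}    w≢[] = ⊥-elim (w≢[] refl)
  λ-label-++ s t {c ∷ w} _    = trans (last-++-∷ s c w) (sym (last-++-∷ t c w))

  reverse-∷ʳ : ∀ (s : List A) c → reverse (s ∷ʳ c) ≡ c ∷ reverse s
  reverse-∷ʳ s c = reverse-++ s (c ∷ [])

module _ {A : Set} {_≺_ : A → A → Set} (sto : IsStrictTotalOrder _≡_ _≺_) where
  open IsStrictTotalOrder sto using (compare; irrefl; asym; _≟_)

  Lex-compare : ∀ s t → Lex _≺_ s t ⊎ s ≡ t ⊎ Lex _≺_ t s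
  Lex-compare []      []      = inj₂ (inj₁ refl)
  Lex-compare []      (_ ∷ _) = inj₁ []<∷
  Lex-compare (_ ∷ _) []      = inj₂ (inj₂ []<∷)
  Lex-compare (x ∷ s) (y ∷ t) with compare x y
  ... | tri< x≺y _ _ = inj₁ (here x≺y)
  ... | tri> _ _ y≺x = inj₂ (inj₂ (here y≺x))
  ... | tri≈ _ refl _ with Lex-compare s t
  ...   | inj₁ s<t        = inj₁ (there s<t)
  ...   | inj₂ (inj₁ refl) = inj₂ (inj₁ refl)
  ...   | inj₂ (inj₂ t<s) = inj₂ (inj₂ (there t<s))

  Lex-∷-between : ∀ {c d s t r} → Lex _≺_ (c ∷ s) (d ∷ t) → Lex _≺_ (d ∷ t) (c ∷ r) →
                  d ≡ c × Lex _≺_ s t × Lex _≺_ t r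
  Lex-∷-between (here c≺d) (here d≺c) = ⊥-elim (asym c≺d d≺c)
  Lex-∷-between (here c≺c) (there _)  = ⊥-elim (irrefl refl c≺c)
  Lex-∷-between (there _)  (here c≺c) = ⊥-elim (irrefl refl c≺c)
  Lex-∷-between (there s<t) (there t<r) = refl , s<t , t<r

  <co-compare : ∀ s t → _<co_ _≺_ s t ⊎ s ≡ t ⊎ _<co_ _≺_ t s
  <co-compare s t with Lex-compare (reverse s) (reverse t)
  ... | inj₁ s<t        = inj₁ s<t
  ... | inj₂ (inj₁ eq)  = inj₂ (inj₁ (reverse-injective eq))
  ... | inj₂ (inj₂ t<s) = inj₂ (inj₂ t<s)

  ∷ʳ-<co : ∀ {s t} c → _<co_ _≺_ s t → _<co_ _≺_ (s ∷ʳ c) (t ∷ʳ c)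
  ∷ʳ-<co {s} {t} c s<t = subst₂ (Lex _≺_) (sym (reverse-∷ʳ s c)) (sym (reverse-∷ʳ t c)) (there s<t)

  ∷ʳ-<co-between : ∀ {s t w c d} → _<co_ _≺_ (s ∷ʳ c) (w ∷ʳ d) → _<co_ _≺_ (w ∷ʳ d) (t ∷ʳ c) →
                   d ≡ c × _<co_ _≺_ s w × _<co_ _≺_ w t
  ∷ʳ-<co-between {s} {t} {w} {c} {d} s<w w<t =
    Lex-∷-between (subst₂ (Lex _≺_) (reverse-∷ʳ s c) (reverse-∷ʳ w d) s<w)
                  (subst₂ (Lex _≺_) (reverse-∷ʳ w d) (reverse-∷ʳ t c) w<t)

  module _ (T : Trie A) where
    open DecMembership (≡-dec _≟_) using (_∈?_)

    Succ-functional : ∀ {s t t′} → Succ _≺_ T s t → Succ _≺_ T s t′ → t ≡ t′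
    Succ-functional {t = t} {t′} (_ , t∈ , s<t , gap) (_ , t′∈ , s<t′ , gap′) with <co-compare t t′
    ... | inj₁ t<t′        = ⊥-elim (gap′ t t∈ s<t t<t′)
    ... | inj₂ (inj₁ eq)   = eq
    ... | inj₂ (inj₂ t′<t) = ⊥-elim (gap t′ t′∈ s<t′ t′<t)

    Succ-∷ʳ : ∀ {s t c} → Succ _≺_ T s t → Out T s c → Out T t c → Succ _≺_ T (s ∷ʳ c) (t ∷ʳ c)
    Succ-∷ʳ {s} {t} {c} (_ , _ , s<t , gap) sc∈ tc∈ = sc∈ , tc∈ , ∷ʳ-<co {s} {t} c s<t , gap′
      where
      gap′ : ∀ w → w ∈ nodes T → _<co_ _≺_ (s ∷ʳ c) w → ¬ _<co_ _≺_ w (t ∷ʳ c)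
      gap′ w w∈ with reverseView w
      ... | []          = λ ()
      ... | w′ ∶ _ ∶ʳ d = λ sc<w w<tc → let _ , s<w′ , w′<t = ∷ʳ-<co-between {s} {t} {w′} {c} {d} sc<w w<tc
                                        in gap w′ (prefix-closed T w′ d w∈) s<w′ w′<t

    ¬Red⇒Out⊆ : ∀ {s t c} → ¬ Red _≺_ T s → Succ _≺_ T s t → Out T s c → Out T t c
    ¬Red⇒Out⊆ {t = t} {c} ¬red s→t sc∈ with (t ∷ʳ c) ∈? nodes T
    ... | yes tc∈ = tc∈
    ... | no  tc∉ = ⊥-elim (¬red (t , s→t , λ same-out → tc∉ (Equivalence.to (same-out c) sc∈)))

    Succ-++ : ∀ {s t w} → Reverse w → Succ _≺_ T s t → (s ++ w) ∈ nodes T →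
              (∀ {w′} → w′ ⊏ w → ¬ Red _≺_ T (s ++ w′)) → Succ _≺_ T (s ++ w) (t ++ w)
    Succ-++ {s} {t} [] s→t _ _ rewrite ++-identityʳ s | ++-identityʳ t = s→t
    Succ-++ {s} {t} (w ∶ rw ∶ʳ c) s→t swc∈ ¬red
      rewrite sym (++-assoc s w (c ∷ [])) | sym (++-assoc t w (c ∷ [])) =
        Succ-∷ʳ sw→tw swc∈ (¬Red⇒Out⊆ (¬red (c , ⊑-refl)) sw→tw swc∈)
      where
      sw→tw : Succ _≺_ T (s ++ w) (t ++ w)
      sw→tw = Succ-++ rw s→t (prefix-closed T (s ++ w) c swc∈) (¬red ∘ ⊏-∷ʳ)

lemma9 : {A : Set} (_≺_ : A → A → Set) → IsStrictTotalOrder _≡_ _≺_ →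
    (T : Trie A) (u : List A) → u ∈ nodes T →
    (∃ λ v → Succ _≺_ T u v) →
    ¬ Colored _≺_ T u →
    (v : List A) → v ∈ nodes T → u ⊑ v → v ≢ u →
    Colored _≺_ T v →
    (∀ (x : List A) → u ⊑ x → x ⊑ v → x ≢ v → ¬ Colored _≺_ T x) →
    Red _≺_ T v × ¬ Blue _≺_ T v
-- ¬ Colored u is the instance x = u of uncolored-path.
lemma9 _≺_ sto T u _ (u′ , u→u′) _ _ v∈ (z , refl) v≢u colored uncolored-path = red , ¬blue
  where
  v→u′z : Succ _≺_ T (u ++ z) (u′ ++ z)
  v→u′z = Succ-++ sto T (reverseView z) u→u′ v∈ λ {w} w⊏z →
    uncolored-path (u ++ w) (w , refl) (++⁺-⊑ u (⊏⇒⊑ w⊏z)) (⊏⇒≢ w⊏z ∘ ++-cancelˡ u w z) ∘ inj₁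

  z≢[] : z ≢ []
  z≢[] refl = v≢u (++-identityʳ u)

  ¬blue : ¬ Blue _≺_ T (u ++ z)
  ¬blue (y , v→y , λ≢) = λ≢ (trans (λ-label-++ u u′ z≢[]) (cong λ-label (Succ-functional sto T v→u′z v→y)))

  red : Red _≺_ T (u ++ z)
  red = [ id , ⊥-elim ∘ ¬blue ]′ colored
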